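{- Let $a, c$ be nonnegative integers. Then there exists a unique nonnegative integer $b$ such that $\mathcal{G}_{\mathcal{R}}(b,a+b) = c$.
   Context: A position is an unordered pair $(a,b)$ of nonnegative integers (pile sizes). $\mathcal{R}$-Wythoff: a move either removes a positive number of tokens from the larger pile (or from either pile if both piles have equal size), or removes the same positive number of tokens from both piles. $\mathcal{G}_{\mathcal{R}}$ is the Sprague-Grundy function of $\mathcal{R}$-Wythoff: $\mathcal{G}_{\mathcal{R}}(p)=\mathrm{mex}\{\mathcal{G}_{\mathcal{R}}(q): q \text{ reachable from } p \text{ in one move}\}$, where $\mathrm{mex}(S)$ is the least nonnegative integer not in $S$ and $\mathrm{mex}\{\}=0$. -}

module Defs where

open import Data.Nat using (ℕ; zero; suc; _+_; _∸_; _⊓_; _⊔_)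
open import Data.Nat.Properties using (_≟_)
open import Data.List using (List; []; _∷_; map; length; _++_; upTo)
open import Data.List.Membership.DecPropositional _≟_ using (_∈?_)
open import Data.Bool using (if_then_else_)
open import Relation.Nullary.Decidable using (does)
open import Data.Product using (_×_; _,_)

-- mex of a finite list: least natural number not occurring in the list.
-- (Search from 0; some n ≤ length l is always absent, so fuel length l suffices.)
mexAux : ℕ → ℕ → List ℕ → ℕ
mexAux zero    n l = n
mexAux (suc f) n l = if does (n ∈? l) then mexAux f (suc n) l else n

mex : List ℕ → ℕ
mex l = mexAux (length l) 0 l

-- Options of the R-Wythoff position {a,b} (unordered; we use lo = min, hi = max):
--  * remove k ≥ 1 tokens from the larger pile: {lo, hi ∸ k}, 1 ≤ k ≤ hi
--    (when a = b this also covers removing from "either" pile, by symmetry);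
--  * remove k ≥ 1 tokens from both piles: {lo ∸ k, hi ∸ k}, 1 ≤ k ≤ lo.
options : ℕ → ℕ → List (ℕ × ℕ)
options a b =
  map (λ i → (lo , hi ∸ suc i)) (upTo hi) ++
  map (λ i → (lo ∸ suc i , hi ∸ suc i)) (upTo lo)
  where
  lo = a ⊓ b
  hi = a ⊔ b

-- Every option of a position has
-- strictly smaller total a + b, so fuel a + b is sufficient (at fuel 0 the
-- position is (0,0), which has no options and value mex {} = 0).
grundyF : ℕ → ℕ → ℕ → ℕ
grundyF zero    a b = 0
grundyF (suc f) a b = mex (map (λ p → grundyF f (Data.Product.proj₁ p) (Data.Product.proj₂ p)) (options a b))

GR : ℕ → ℕ → ℕ
GR a b = grundyF (a + b) a b

module Submission where

-- Fix a, c and write g(b) = G_R(b, a + b) for the values along the diagonal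
-- of offset a.  Uniqueness: for b' < b the position (b', a + b') is reached
-- from (b, a + b) by a diagonal move, so g is injective.
--
-- Existence is a counting argument.  Let M = 2(c + a) and suppose that c is
-- missed by g(0), …, g(M).  Every b ≤ M then receives a code k < M:
--   * if g(b) < c, the code is g(b);
--   * otherwise g(b) > c, so some option of (b, a + b) has value c.  A diagonal
--     option is an earlier diagonal point, excluded by assumption, so it is a
--     row option (b, y) with y < a + b.  If y ≥ b the code is c + (y - b);
--   * if y < b, then G_R(y, b) = c, no row position (y, y') with y' < y has
--     value c, so the first two rules give y a code k₀ < c + a, and the code
--     of b is (c + a) + k₀.
-- Since row moves and diagonal moves separate Grundy values, the code of b
-- determines b: M + 1 points are coded injectively by M numbers, which the
-- pigeonhole principle forbids.

open import Defs
open import Data.Nat using (ℕ; zero; suc; _+_; _∸_; _⊓_; _⊔_; _≤_; _<_; s≤s)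
open import Data.Nat.Properties
open import Data.List using (List; map; length; _++_; upTo; lookup)
open import Data.List.Properties using (map-cong-local)
open import Data.List.Membership.Propositional using (_∈_; _∉_)
open import Data.List.Membership.Propositional.Properties
  using (∈-map⁺; ∈-map⁻; ∈-++⁺ˡ; ∈-++⁺ʳ; ∈-++⁻; ∈-upTo⁺; ∈-upTo⁻)
open import Data.List.Membership.DecPropositional _≟_ using (_∈?_)
open import Data.List.Relation.Unary.All using (tabulate)
open import Data.List.Relation.Unary.Any using (index)
open import Data.List.Relation.Unary.Any.Properties using (lookup-index)
open import Data.Fin using (Fin; toℕ; fromℕ<)
open import Data.Fin.Properties using (pigeonhole; toℕ<n; toℕ-mono-<; toℕ-fromℕ<; toℕ-injective)
open import Data.Product using (_×_; _,_; proj₁; proj₂; ∃; ∃!; uncurry)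
open import Data.Sum using (_⊎_; inj₁; inj₂)
open import Data.Empty using (⊥; ⊥-elim)
open import Data.Unit using (⊤; tt)
open import Relation.Nullary using (¬_; yes; no)
open import Relation.Binary.Definitions using (tri<; tri≈; tri>)
open import Relation.Binary.PropositionalEquality

no-injection : (n : ℕ) (f : (i : ℕ) → i ≤ n → ℕ) →
               (∀ i p → f i p < n) → (∀ i j p q → f i p ≡ f j q → i ≡ j) → ⊥
no-injection n f bounded injective =
  let i , j , i<j , Fi≡Fj = pigeonhole (n<1+n n) F
  in <-irrefl (injective _ _ _ _ (F-reflects Fi≡Fj)) (toℕ-mono-< i<j)
  where
  F : Fin (suc n) → Fin n
  F i = fromℕ< (bounded (toℕ i) (≤-pred (toℕ<n i)))
  F-reflects : ∀ {i j} → F i ≡ F j → f (toℕ i) (≤-pred (toℕ<n i)) ≡ f (toℕ j) (≤-pred (toℕ<n j))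
  F-reflects Fi≡Fj = trans (sym (toℕ-fromℕ< _)) (trans (cong toℕ Fi≡Fj) (toℕ-fromℕ< _))

-- A list l cannot contain all of 0, …, length l: their positions in l would
-- be pairwise distinct.
not-all-in : (l : List ℕ) → ¬ (∀ m → m ≤ length l → m ∈ l)
not-all-in l mem = no-injection (length l) position (λ _ _ → toℕ<n _) distinct
  where
  position : (m : ℕ) → m ≤ length l → ℕ
  position m p = toℕ (index (mem m p))
  distinct : ∀ i j p q → position i p ≡ position j q → i ≡ j
  distinct i j p q e = begin
    i                           ≡⟨ lookup-index (mem i p) ⟩
    lookup l (index (mem i p))  ≡⟨ cong (lookup l) (toℕ-injective e) ⟩
    lookup l (index (mem j q))  ≡⟨ sym (lookup-index (mem j q)) ⟩
    j                           ∎
    where open ≡-Reasoning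

below-suc : ∀ {n l} → (∀ m → m < n → m ∈ l) → n ∈ l → ∀ m → m < suc n → m ∈ l
below-suc below n∈l m m<1+n with m<1+n⇒m<n∨m≡n m<1+n
... | inj₁ m<n  = below m m<n
... | inj₂ refl = n∈l

mexAux-spec : ∀ f n l → f + n ≡ length l → (∀ m → m < n → m ∈ l) →
              mexAux f n l ∉ l × (∀ m → m < mexAux f n l → m ∈ l)
mexAux-spec zero n l refl below =
  (λ n∈l → not-all-in l (λ m m≤n → below-suc below n∈l m (s≤s m≤n))) , below
mexAux-spec (suc f) n l eq below with n ∈? l
... | yes n∈l = mexAux-spec f (suc n) l (trans (+-suc f n) eq) (below-suc below n∈l)
... | no  n∉l = n∉l , below

mex-∉ : ∀ l → mex l ∉ l
mex-∉ l = proj₁ (mexAux-spec (length l) 0 l (+-identityʳ _) (λ _ ()))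

mex-minimal : ∀ l m → m < mex l → m ∈ l
mex-minimal l = proj₂ (mexAux-spec (length l) 0 l (+-identityʳ _) (λ _ ()))

rowOptions diagOptions : ℕ → ℕ → List (ℕ × ℕ)
rowOptions  lo hi = map (λ i → (lo , hi ∸ suc i)) (upTo hi)
diagOptions lo hi = map (λ i → (lo ∸ suc i , hi ∸ suc i)) (upTo lo)

options-cases : ∀ {q} lo hi → q ∈ rowOptions lo hi ++ diagOptions lo hi →
  (∃ λ i → i < hi × q ≡ (lo , hi ∸ suc i)) ⊎ (∃ λ i → i < lo × q ≡ (lo ∸ suc i , hi ∸ suc i))
options-cases lo hi q∈ with ∈-++⁻ (rowOptions lo hi) q∈
... | inj₁ q∈row  with i , i∈ , q≡ ← ∈-map⁻ _ q∈row  = inj₁ (i , ∈-upTo⁻ i∈ , q≡)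
... | inj₂ q∈diag with i , i∈ , q≡ ← ∈-map⁻ _ q∈diag = inj₂ (i , ∈-upTo⁻ i∈ , q≡)

countdown-< : ∀ {i n} → i < n → n ∸ suc i < n
countdown-< {i} {suc n} _ = s≤s (m∸n≤m n i)

countdown-involutive : ∀ {i n} → i < n → n ∸ suc (n ∸ suc i) ≡ i
countdown-involutive {n = suc n} (s≤s i≤n) = m∸[m∸n]≡n i≤n

min+max : ∀ a b → (a ⊓ b) + (a ⊔ b) ≡ a + b
min+max a b with ≤-total a b
... | inj₁ a≤b rewrite m≤n⇒m⊓n≡m a≤b | m≤n⇒m⊔n≡n a≤b = refl
... | inj₂ b≤a rewrite ⊓-comm a b | ⊔-comm a b | m≤n⇒m⊓n≡m b≤a | m≤n⇒m⊔n≡n b≤a = +-comm b a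

-- Every move removes at least one token; this makes G_R well founded.
option-smaller : ∀ {q} a b → q ∈ options a b → proj₁ q + proj₂ q < a + b
option-smaller a b q∈ with options-cases (a ⊓ b) (a ⊔ b) q∈
... | inj₁ (i , i< , refl) =
  subst ((a ⊓ b) + (a ⊔ b ∸ suc i) <_) (min+max a b) (+-monoʳ-< (a ⊓ b) (countdown-< i<))
... | inj₂ (i , i< , refl) =
  subst ((a ⊓ b ∸ suc i) + (a ⊔ b ∸ suc i) <_) (min+max a b)
        (+-mono-<-≤ (countdown-< i<) (m∸n≤m (a ⊔ b) (suc i)))

G : ℕ × ℕ → ℕ
G = uncurry GR

grundyF-fuel : ∀ f f' a b → a + b ≤ f → a + b ≤ f' → grundyF f a b ≡ grundyF f' a b
grundyF-fuel zero    zero     a    b    _ _  = refl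
grundyF-fuel zero    (suc f') zero zero _ _  = refl
grundyF-fuel (suc f) zero     zero zero _ _  = refl
grundyF-fuel (suc f) (suc f') a    b    p p' =
  cong mex (map-cong-local (tabulate λ {q} q∈ →
    grundyF-fuel f f' (proj₁ q) (proj₂ q)
      (≤-pred (≤-trans (option-smaller a b q∈) p))
      (≤-pred (≤-trans (option-smaller a b q∈) p'))))

GR-unfold : ∀ a b → GR a b ≡ mex (map G (options a b))
GR-unfold a b = begin
  grundyF (a + b) a b
    ≡⟨ grundyF-fuel (a + b) (suc (a + b)) a b ≤-refl (n≤1+n _) ⟩
  mex (map (λ q → grundyF (a + b) (proj₁ q) (proj₂ q)) (options a b))
    ≡⟨ cong mex (map-cong-local (tabulate λ {q} q∈ →
         grundyF-fuel _ _ (proj₁ q) (proj₂ q) (<⇒≤ (option-smaller a b q∈)) ≤-refl)) ⟩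
  mex (map G (options a b))
    ∎
  where open ≡-Reasoning

option-≢ : ∀ {q a b} → q ∈ options a b → G q ≢ GR a b
option-≢ {q} {a} {b} q∈ Gq≡ =
  mex-∉ (map G (options a b))
        (subst (_∈ map G (options a b)) (trans Gq≡ (GR-unfold a b)) (∈-map⁺ G q∈))

option-reaching : ∀ {a b c} → c < GR a b → ∃ λ q → q ∈ options a b × G q ≡ c
option-reaching {a} {b} {c} c< with ∈-map⁻ G (mex-minimal _ c (subst (c <_) (GR-unfold a b) c<))
... | q , q∈ , c≡Gq = q , q∈ , sym c≡Gq

-- Positions are unordered: the options depend only on min and max.
GR-sym : ∀ a b → GR a b ≡ GR b a
GR-sym a b = begin
  GR a b                    ≡⟨ GR-unfold a b ⟩
  mex (map G (options a b)) ≡⟨ cong₂ (λ lo hi → mex (map G (rowOptions lo hi ++ diagOptions lo hi)))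
                                     (⊓-comm a b) (⊔-comm a b) ⟩
  mex (map G (options b a)) ≡⟨ sym (GR-unfold b a) ⟩
  GR b a                    ∎
  where open ≡-Reasoning

-- Every position with x ≤ y is (x, d + x) for d = y ∸ x; then x is the smaller pile.
options-normal : ∀ d x → options x (d + x) ≡ rowOptions x (d + x) ++ diagOptions x (d + x)
options-normal d x = cong₂ (λ lo hi → rowOptions lo hi ++ diagOptions lo hi)
                           (m≤n⇒m⊓n≡m (m≤n+m x d)) (m≤n⇒m⊔n≡n (m≤n+m x d))

row-option : ∀ {d x y} → y < d + x → (x , y) ∈ options x (d + x)
row-option {d} {x} {y} y< = subst ((x , y) ∈_) (sym (options-normal d x)) (∈-++⁺ˡ y∈row)
  where
  y∈row : (x , y) ∈ rowOptions x (d + x)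
  y∈row = subst (λ z → (x , z) ∈ rowOptions x (d + x)) (countdown-involutive y<)
                (∈-map⁺ (λ i → (x , d + x ∸ suc i)) (∈-upTo⁺ (countdown-< y<)))

diag-option : ∀ {d x x'} → x' < x → (x' , d + x') ∈ options x (d + x)
diag-option {d} {x} {x'} x'<x =
  subst ((x' , d + x') ∈_) (sym (options-normal d x)) (∈-++⁺ʳ (rowOptions x (d + x)) x'∈diag)
  where
  shift : d + x ∸ suc (x ∸ suc x') ≡ d + x'
  shift = trans (+-∸-assoc d (countdown-< x'<x)) (cong (d +_) (countdown-involutive x'<x))
  x'∈diag : (x' , d + x') ∈ diagOptions x (d + x)
  x'∈diag = subst₂ (λ u v → (u , v) ∈ diagOptions x (d + x)) (countdown-involutive x'<x) shift
                   (∈-map⁺ (λ i → (x ∸ suc i , d + x ∸ suc i)) (∈-upTo⁺ (countdown-< x'<x)))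

normal-options-cases : ∀ {q} d x → q ∈ options x (d + x) →
  (∃ λ y → y < d + x × q ≡ (x , y)) ⊎ (∃ λ x' → x' < x × q ≡ (x' , d + x'))
normal-options-cases d x q∈ with options-cases x (d + x) (subst (_ ∈_) (options-normal d x) q∈)
... | inj₁ (i , i< , q≡) = inj₁ (_ , countdown-< i< , q≡)
... | inj₂ (i , i< , q≡) = inj₂ (_ , countdown-< i< , trans q≡ (cong (x ∸ suc i ,_) (+-∸-assoc d i<)))

row-≢ : ∀ {x y y'} → x ≤ y → y' < y → GR x y' ≢ GR x y
row-≢ {x} {y} {y'} x≤y y'<y = subst (λ z → GR x y' ≢ GR x z) (m∸n+n≡m x≤y)
  (option-≢ {a = x} {b = (y ∸ x) + x} (row-option {y ∸ x} (subst (y' <_) (sym (m∸n+n≡m x≤y)) y'<y)))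

diagonal-≢ : ∀ d {x x'} → x' < x → GR x' (d + x') ≢ GR x (d + x)
diagonal-≢ d {x} x'<x = option-≢ {a = x} {b = d + x} (diag-option x'<x)

diagonal-below : ∀ d x {c} → c < GR x (d + x) →
  (∃ λ y → y < d + x × GR x y ≡ c) ⊎ (∃ λ x' → x' < x × GR x' (d + x') ≡ c)
diagonal-below d x c< with option-reaching {x} {d + x} c<
... | q , q∈ , Gq≡c with normal-options-cases d x q∈
...   | inj₁ (y  , y<  , refl) = inj₁ (y  , y<  , Gq≡c)
...   | inj₂ (x' , x'< , refl) = inj₂ (x' , x'< , Gq≡c)

separated⇒injective : (P : ℕ → Set) (f : ℕ → ℕ) → (∀ {i j} → P i → P j → i < j → f i ≢ f j) →
                      ∀ {i j} → P i → P j → f i ≡ f j → i ≡ j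
separated⇒injective P f separated {i} {j} Pi Pj fi≡fj with <-cmp i j
... | tri< i<j _ _ = ⊥-elim (separated Pi Pj i<j fi≡fj)
... | tri≈ _ i≡j _ = i≡j
... | tri> _ _ j<i = ⊥-elim (separated Pj Pi j<i (sym fi≡fj))

diagonal-injective : ∀ d {b b'} → GR b (d + b) ≡ GR b' (d + b') → b ≡ b'
diagonal-injective d = separated⇒injective (λ _ → ⊤) (λ b → GR b (d + b)) (λ _ _ → diagonal-≢ d) tt tt

row-injective : ∀ {x y y'} → x ≤ y → x ≤ y' → GR x y ≡ GR x y' → y ≡ y'
row-injective {x} = separated⇒injective (x ≤_) (GR x) (λ _ x≤j i<j → row-≢ x≤j i<j)

module Coding (a c : ℕ) where

  g : ℕ → ℕ
  g b = GR b (a + b)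

  data Code₀ (b : ℕ) : ℕ → Set where
    low  : ∀ {k} → g b < c → g b ≡ k → Code₀ b k
    high : ∀ {k} δ → δ < a → GR b (δ + b) ≡ c → c + δ ≡ k → Code₀ b k

  data Code (b : ℕ) : ℕ → Set where
    direct  : ∀ {k} → Code₀ b k → Code b k
    via-row : ∀ {k k₀} j → j < b → GR j b ≡ c → Code₀ j k₀ → (c + a) + k₀ ≡ k → Code b k

  M : ℕ
  M = (c + a) + (c + a)

  code₀-bound : ∀ {b k} → Code₀ b k → k < c + a
  code₀-bound (low gb<c refl)     = <-≤-trans gb<c (m≤m+n c a)
  code₀-bound (high δ δ<a _ refl) = +-monoʳ-< c δ<a

  code-bound : ∀ {b k} → Code b k → k < M
  code-bound (direct κ)             = <-≤-trans (code₀-bound κ) (m≤m+n (c + a) (c + a))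
  code-bound (via-row _ _ _ κ refl) = +-monoʳ-< (c + a) (code₀-bound κ)

  low≢high : ∀ {m} δ → m < c → c + δ ≢ m
  low≢high δ m<c c+δ≡m = <⇒≱ m<c (subst (c ≤_) c+δ≡m (m≤m+n c δ))

  -- Low codes are separated by diagonal moves, high ones with the same
  -- offset δ by diagonal moves along the diagonal of offset δ.
  code₀-injective : ∀ {b b' k} → Code₀ b k → Code₀ b' k → b ≡ b'
  code₀-injective (low _ gb≡k) (low _ gb'≡k) = diagonal-injective a (trans gb≡k (sym gb'≡k))
  code₀-injective (low gb<c refl) (high δ _ _ e) = ⊥-elim (low≢high δ gb<c e)
  code₀-injective (high δ _ _ e) (low gb'<c refl) = ⊥-elim (low≢high δ gb'<c e)
  code₀-injective (high δ _ Gb refl) (high δ' _ Gb' e) with +-cancelˡ-≡ c δ' δ e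
  ... | refl = diagonal-injective δ (trans Gb (sym Gb'))

  -- Shifted codes are determined by j (first-level injectivity), and then b
  -- by a row move along the row of j.
  code-injective : ∀ {b b' k} → Code b k → Code b' k → b ≡ b'
  code-injective (direct κ) (direct κ') = code₀-injective κ κ'
  code-injective (direct κ) (via-row _ _ _ _ refl) = ⊥-elim (m+n≮m (c + a) _ (code₀-bound κ))
  code-injective (via-row _ _ _ _ refl) (direct κ') = ⊥-elim (m+n≮m (c + a) _ (code₀-bound κ'))
  code-injective (via-row j j<b Gjb κ refl) (via-row j' j'<b' Gj'b' κ' e)
    with +-cancelˡ-≡ (c + a) _ _ e
  ... | refl with code₀-injective κ κ'
  ...   | refl = row-injective (<⇒≤ j<b) (<⇒≤ j'<b') (trans Gjb (sym Gj'b'))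

  Avoids : ℕ → Set
  Avoids n = ∀ b → b < n → g b ≢ c

  avoids-mono : ∀ {m n} → m ≤ n → Avoids n → Avoids m
  avoids-mono m≤n av b b<m = av b (<-≤-trans b<m m≤n)

  avoids-suc : ∀ {n} → Avoids n → g n ≢ c → Avoids (suc n)
  avoids-suc av gn≢c b b<1+n with m<1+n⇒m<n∨m≡n b<1+n
  ... | inj₁ b<n  = av b b<n
  ... | inj₂ refl = gn≢c

  search : ∀ n → Avoids n ⊎ ∃ λ b → g b ≡ c
  search zero = inj₁ (λ _ ())
  search (suc n) with search n
  ... | inj₂ hit = inj₂ hit
  ... | inj₁ av with g n ≟ c
  ...   | yes gn≡c = inj₂ (n , gn≡c)
  ...   | no  gn≢c = inj₁ (avoids-suc av gn≢c)

  -- If c is absent up to b, then g(b) < c or c is the value of a row option of (b, a + b):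
  -- the diagonal options are earlier diagonal points.
  classify : ∀ b → Avoids (suc b) → g b < c ⊎ ∃ λ y → y < a + b × GR b y ≡ c
  classify b av with <-cmp (g b) c
  ... | tri< gb<c _ _ = inj₁ gb<c
  ... | tri≈ _ gb≡c _ = ⊥-elim (av b ≤-refl gb≡c)
  ... | tri> _ _ c<gb with diagonal-below a b c<gb
  ...   | inj₁ row-hit = inj₂ row-hit
  ...   | inj₂ (x' , x'<b , gx'≡c) = ⊥-elim (av x' (m<n⇒m<1+n x'<b) gx'≡c)

  high-code : ∀ {b y} → b ≤ y → y < a + b → GR b y ≡ c → Code₀ b (c + (y ∸ b))
  high-code {b} {y} b≤y y< Gby =
    high (y ∸ b) (subst (y ∸ b <_) (m+n∸n≡m a b) (∸-monoˡ-< y< b≤y))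
         (subst (λ z → GR b z ≡ c) (sym (m∸n+n≡m b≤y)) Gby) refl

  code₀-exists : ∀ j → Avoids (suc j) → (∀ y → y < j → GR j y ≢ c) → ∃ (Code₀ j)
  code₀-exists j av no-row with classify j av
  ... | inj₁ gj<c = g j , low gj<c refl
  ... | inj₂ (y , y< , Gjy) with y <? j
  ...   | yes y<j = ⊥-elim (no-row y y<j Gjy)
  ...   | no  y≮j = _ , high-code (≮⇒≥ y≮j) y< Gjy

  -- If (y, b) with y < b has value c, then no earlier position of the row of y
  -- does, so y has a first-level code.
  via-row-code : ∀ {b y} → Avoids (suc b) → y < b → GR y b ≡ c → ∃ (Code b)
  via-row-code {b} {y} av y<b Gyb =
    _ , via-row y y<b Gyb (proj₂ (code₀-exists y (avoids-mono (s≤s (<⇒≤ y<b)) av) no-row)) refl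
    where
    no-row : ∀ y' → y' < y → GR y y' ≢ c
    no-row y' y'<y Gyy' = row-≢ (<⇒≤ y<b) (<-trans y'<y y<b) (trans Gyy' (sym Gyb))

  code-exists : ∀ b → Avoids (suc b) → ∃ (Code b)
  code-exists b av with classify b av
  ... | inj₁ gb<c = g b , direct (low gb<c refl)
  ... | inj₂ (y , y< , Gby) with y <? b
  ...   | no  y≮b = _ , direct (high-code (≮⇒≥ y≮b) y< Gby)
  ...   | yes y<b = via-row-code av y<b (trans (GR-sym y b) Gby)

  attained : ∃ λ b → g b ≡ c
  attained with search (suc M)
  ... | inj₂ hit = hit
  ... | inj₁ av = ⊥-elim (no-injection M code (λ b p → code-bound (proj₂ (coded b p))) distinct)
    where
    coded : ∀ b → b ≤ M → ∃ (Code b)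
    coded b b≤M = code-exists b (avoids-mono (s≤s b≤M) av)
    code : (b : ℕ) → b ≤ M → ℕ
    code b b≤M = proj₁ (coded b b≤M)
    distinct : ∀ i j p q → code i p ≡ code j q → i ≡ j
    distinct i j p q e = code-injective (proj₂ (coded i p)) (subst (Code j) (sym e) (proj₂ (coded j q)))

theorem2p8 : (a c : ℕ) → ∃! _≡_ (λ b → GR b (a + b) ≡ c)
theorem2p8 a c with Coding.attained a c
... | b , gb≡c = b , gb≡c , λ gb'≡c → diagonal-injective a (trans gb≡c (sym gb'≡c))
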